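{- Let $R$ be a commutative ring with unity and $n\ge1$. Let $a(0)\in R$, $a(i),b(i)\in R$ for $1\le i\le n$, and $c(i',j')\in R$ for $2\le i'\le n$, $1\le j'\le\binom{n}{i'}$. Define $$S'_n=\sum_{k=0}^{2^n-1}\left(a(0)+\sum_{i=1}^n(-1)^{k(i)}b(i)a(i)+\sum_{i'=2}^n\sum_{j'=1}^{\binom{n}{i'}}(-1)^{\sum_{\alpha=1}^{i'}k(s_\alpha)}c(i',j')\prod_{\alpha=1}^{i'}a(s_\alpha)\right)^2.$$ Then $$S'_n=2^n\left(a(0)^2+\sum_{i=1}^n\big(a(i)b(i)\big)^2+\sum_{i'=2}^n\sum_{j'=1}^{\binom{n}{i'}}c(i',j')^2\prod_{\alpha=1}^{i'}a(s_\alpha)^2\right).$$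
   Context: For an integer $0\le k\le 2^n-1$, write $k=\sum_{j=1}^{n}t_j2^{j-1}$ with $t_j\in\{0,1\}$ and set $k(j)=t_j$. Indexing convention: for each $i'\in\{2,\dots,n\}$, the index $j'\in\{1,\dots,\binom{n}{i'}\}$ runs bijectively over the $i'$-element subsets $\{s_1<\dots<s_{i'}\}$ of $\{1,\dots,n\}$, and in the term indexed by $(i',j')$ the symbols $s_1,\dots,s_{i'}$ denote the elements of that subset. -}

module Defs where

open import Level using (Level)
open import Algebra.Bundles using (CommutativeRing)
open import Data.Nat as ℕ using (ℕ; zero; suc; _∸_; _/_; _%_)
open import Data.Nat.Properties using (_≟_; m^n≢0)
open import Data.Fin using (Fin; toℕ)
open import Data.Fin.Subset using (Subset; inside; outside; ∣_∣)
open import Data.Fin.Subset.Properties using (_∈?_)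
open import Data.List using (List; []; _∷_; [_]; _++_; map; foldr; filter; upTo; allFin)
open import Data.Vec using (Vec)
  renaming ([] to []ᵥ; _∷_ to _∷ᵥ_)

-- k(i) for i ∈ Fin n representing index (toℕ i + 1) ∈ {1..n}:
-- the (toℕ i + 1)-th binary digit of k, i.e. ⌊k / 2^(toℕ i)⌋ mod 2
bit : ∀ {n} → ℕ → Fin n → ℕ
bit k i = (k / (2 ℕ.^ toℕ i)) ⦃ m^n≢0 2 (toℕ i) ⦄ % 2

allSubsets : ∀ n → List (Subset n)
allSubsets zero = [ []ᵥ ]
allSubsets (suc n) = map (outside ∷ᵥ_) (allSubsets n) ++ map (inside ∷ᵥ_) (allSubsets n)

subsetsOfSize : ∀ n → ℕ → List (Subset n)
subsetsOfSize n i' = filter (λ s → ∣ s ∣ ≟ i') (allSubsets n)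

elems : ∀ {n} → Subset n → List (Fin n)
elems {n} s = filter (_∈? s) (allFin n)

from2to : ℕ → List ℕ
from2to n = map (λ m → m ℕ.+ 2) (upTo (n ∸ 1))

module RingDefs {c ℓ : Level} (R : CommutativeRing c ℓ) where
  open CommutativeRing R

  sumL : List Carrier → Carrier
  sumL = foldr _+_ 0#

  prodL : List Carrier → Carrier
  prodL = foldr _*_ 1#

  pow : Carrier → ℕ → Carrier
  pow x zero = 1#
  pow x (suc m) = x * pow x m

  sgn : ℕ → Carrier
  sgn e = pow (- 1#) e

  inner : (n : ℕ) → Carrier → (Fin n → Carrier) → (Fin n → Carrier)
        → (Subset n → Carrier) → ℕ → Carrier
  inner n a₀ a b c' k =
    a₀
    + sumL (map (λ i → sgn (bit k i) * b i * a i) (allFin n))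
    + sumL (map (λ i' → sumL (map (λ s →
          sgn (foldr ℕ._+_ 0 (map (bit k) (elems s)))
            * c' s * prodL (map a (elems s)))
        (subsetsOfSize n i'))) (from2to n))

  S′ : (n : ℕ) → Carrier → (Fin n → Carrier) → (Fin n → Carrier)
     → (Subset n → Carrier) → Carrier
  S′ n a₀ a b c' =
    sumL (map (λ k → pow (inner n a₀ a b c' k) 2) (upTo (2 ℕ.^ n)))

  RHS : (n : ℕ) → Carrier → (Fin n → Carrier) → (Fin n → Carrier)
      → (Subset n → Carrier) → Carrier
  RHS n a₀ a b c' =
    pow (1# + 1#) n *
      ( pow a₀ 2
      + sumL (map (λ i → pow (a i * b i) 2) (allFin n))
      + sumL (map (λ i' → sumL (map (λ s →
            pow (c' s) 2 * prodL (map (λ α → pow (a α) 2) (elems s)))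
          (subsetsOfSize n i'))) (from2to n)))

module Submission where

-- Write χₛ(k) = (-1)^(Σ_{i∈s} k(i)) for s ⊆ {1,…,n}. For each k the bracket in S'_n is
-- Σₛ wₛ χₛ(k), where s runs once over ∅, the singletons and the subsets of size at least 2,
-- with weights a(0), b(i)a(i) and c(i',j') ∏ a(s_α). As k ↦ (k(1),…,k(n)) enumerates {0,1}ⁿ,
-- the sum Σₖ χₛ(k) χₜ(k) factorises over the coordinates: a coordinate lying in both or
-- neither of s, t contributes 2, one lying in exactly one of them contributes 1 + (-1) = 0.
-- So the χₛ are orthogonal of norm 2ⁿ, and Parseval's identity gives S'_n = 2ⁿ Σₛ wₛ²,
-- which is the right-hand side.

open import Defs
open import Level using (Level)
open import Algebra.Bundles using (CommutativeSemiring; CommutativeRing)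
open import Data.Nat as ℕ using (ℕ; zero; suc; _∸_; _/_; _%_; _^_; _≤_; z≤n; s≤s)
open import Data.Nat.DivMod using (n/1≡n; m/n/o≡m/[n*o]; m/n≡1+[m∸n]/n)
open import Data.Nat.Properties as ℕₚ using (m^n≢0)
open import Data.Fin using (Fin; toℕ) renaming (zero to fzero; suc to fsuc)
open import Data.Vec.Functional using (Vector) renaming (_∷_ to _◂_)
open import Data.Bool using (true; false; if_then_else_)
open import Data.Empty using (⊥-elim)
open import Data.Fin.Subset using (Subset; inside; outside; ⊥; ⁅_⁆; ∣_∣) renaming (_∈_ to _∈ₛ_)
open import Data.Fin.Subset.Properties using (_∈?_; ∣⊥∣≡0; ∣⁅x⁆∣≡1; x∈⁅x⁆; x∈⁅y⁆⇒x≡y)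
open import Data.Vec using () renaming ([] to []ᵥ; _∷_ to _∷ᵥ_)
open import Data.Vec.Properties using (∷-injectiveˡ; ∷-injectiveʳ)
open import Data.List
  using (List; []; _∷_; _++_; map; concat; foldr; filter; applyUpTo; allFin; tabulate)
open import Data.List.Membership.Propositional using (_∈_)
open import Data.List.Membership.Propositional.Properties
  using (∈-map⁻; ∈-filter⁻; ∈-concat⁻′; ∈-++⁻)
open import Data.List.Relation.Binary.Disjoint.Propositional using (Disjoint)
open import Data.List.Properties
  using (map-tabulate; map-∘; map-++; map-cong; map-id; concat-map)
open import Relation.Nullary using (does)
open import Function using (_∘_; id)
open import Data.Product using (_×_; _,_; proj₁; proj₂)
open import Data.Sum using (inj₁; inj₂)
open import Data.List.Relation.Unary.All as All using (All; []; _∷_)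
import Data.List.Relation.Unary.All.Properties as All
open import Data.List.Relation.Unary.AllPairs as AllPairs using ([]; _∷_)
import Data.List.Relation.Unary.AllPairs.Properties as AllPairs
open import Data.List.Relation.Unary.Unique.Propositional using (Unique)
import Data.List.Relation.Unary.Unique.Propositional.Properties as Unique
open import Relation.Binary.PropositionalEquality as ≡ using (_≡_; _≗_; _≢_)

double : ℕ → ℕ
double zero = zero
double (suc m) = suc (suc (double m))

double≡2* : ∀ m → double m ≡ 2 ℕ.* m
double≡2* zero = ≡.refl
double≡2* (suc m) = ≡.trans (≡.cong (suc ∘ suc) (double≡2* m)) (≡.sym (ℕₚ.*-suc 2 m))

2^-suc : ∀ n → 2 ^ suc n ≡ double (2 ^ n)
2^-suc n = ≡.sym (double≡2* (2 ^ n))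

double/2 : ∀ k → double k / 2 ≡ k
double/2 zero = ≡.refl
double/2 (suc k) =
  ≡.trans (m/n≡1+[m∸n]/n {suc (suc (double k))} {2} (s≤s (s≤s z≤n))) (≡.cong suc (double/2 k))

1+double/2 : ∀ k → suc (double k) / 2 ≡ k
1+double/2 zero = ≡.refl
1+double/2 (suc k) =
  ≡.trans (m/n≡1+[m∸n]/n {suc (suc (suc (double k)))} {2} (s≤s (s≤s z≤n))) (≡.cong suc (1+double/2 k))

double%2 : ∀ k → double k % 2 ≡ 0
double%2 zero = ≡.refl
double%2 (suc k) = double%2 k

1+double%2 : ∀ k → suc (double k) % 2 ≡ 1
1+double%2 zero = ≡.refl
1+double%2 (suc k) = 1+double%2 k

bit-zero : ∀ {n} k → bit {suc n} k fzero ≡ k % 2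
bit-zero k = ≡.cong (_% 2) (n/1≡n k)

bit-suc : ∀ {n} k (i : Fin n) → bit k (fsuc i) ≡ bit (k / 2) i
bit-suc k i = ≡.cong (_% 2)
  (≡.sym (m/n/o≡m/[n*o] k 2 (2 ^ toℕ i) ⦃ _ ⦄ ⦃ m^n≢0 2 (toℕ i) ⦄ ⦃ m^n≢0 2 (suc (toℕ i)) ⦄))

bit-double : ∀ {n} k → bit {suc n} (double k) ≗ 0 ◂ bit k
bit-double {n} k fzero = ≡.trans (bit-zero {n} (double k)) (double%2 k)
bit-double k (fsuc i) = ≡.trans (bit-suc (double k) i) (≡.cong (λ m → bit m i) (double/2 k))

bit-1+double : ∀ {n} k → bit {suc n} (suc (double k)) ≗ 1 ◂ bit k
bit-1+double {n} k fzero = ≡.trans (bit-zero {n} (suc (double k))) (1+double%2 k)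
bit-1+double k (fsuc i) =
  ≡.trans (bit-suc (suc (double k)) i) (≡.cong (λ m → bit m i) (1+double/2 k))

allSubsets-unique : ∀ n → Unique (allSubsets n)
allSubsets-unique zero = [] ∷ []
allSubsets-unique (suc n) =
  Unique.++⁺ (Unique.map⁺ ∷-injectiveʳ (allSubsets-unique n))
             (Unique.map⁺ ∷-injectiveʳ (allSubsets-unique n))
             heads-differ
  where
  heads-differ : Disjoint (map (outside ∷ᵥ_) (allSubsets n)) (map (inside ∷ᵥ_) (allSubsets n))
  heads-differ (p , q) with ∈-map⁻ (outside ∷ᵥ_) p | ∈-map⁻ (inside ∷ᵥ_) q
  ... | _ , _ , ≡.refl | _ , _ , eq with ∷-injectiveˡ eq
  ... | ()

∈-subsetsOfSize⇒∣∣≡ : ∀ {n m s} → s ∈ subsetsOfSize n m → ∣ s ∣ ≡ m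
∈-subsetsOfSize⇒∣∣≡ {n} {m} s∈ =
  proj₂ (∈-filter⁻ (λ s → ∣ s ∣ ℕₚ.≟ m) {xs = allSubsets n} s∈)

⁅⁆-injective : ∀ {n} {i j : Fin n} → ⁅ i ⁆ ≡ ⁅ j ⁆ → i ≡ j
⁅⁆-injective {i = i} {j} eq = x∈⁅y⁆⇒x≡y j (≡.subst (i ∈ₛ_) eq (x∈⁅x⁆ i))

singletons : ∀ n → List (Subset n)
singletons n = map ⁅_⁆ (allFin n)

largeSubsets : ∀ n → List (Subset n)
largeSubsets n = concat (map (subsetsOfSize n) (from2to n))

∈-singletons⇒∣∣≡1 : ∀ {n s} → s ∈ singletons n → ∣ s ∣ ≡ 1
∈-singletons⇒∣∣≡1 s∈ with ∈-map⁻ ⁅_⁆ s∈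
... | i , _ , ≡.refl = ∣⁅x⁆∣≡1 i

∈-largeSubsets⇒2≤∣∣ : ∀ {n s} → s ∈ largeSubsets n → 2 ≤ ∣ s ∣
∈-largeSubsets⇒2≤∣∣ {n} s∈ with ∈-concat⁻′ (map (subsetsOfSize n) (from2to n)) s∈
... | _ , s∈xs , xs∈ with ∈-map⁻ (subsetsOfSize n) xs∈
... | m , m∈ , ≡.refl with ∈-map⁻ (ℕ._+ 2) m∈
... | k , _ , ≡.refl = ≡.subst (2 ≤_) (≡.sym (∈-subsetsOfSize⇒∣∣≡ s∈xs)) (ℕₚ.m≤n+m 2 k)

largeSubsets-unique : ∀ n → Unique (largeSubsets n)
largeSubsets-unique n = Unique.concat⁺
  (All.map⁺ (All.tabulate (λ _ → Unique.filter⁺ _ (allSubsets-unique n))))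
  (AllPairs.map⁺ (AllPairs.map sizes-differ from2to-unique))
  where
  from2to-unique : Unique (from2to n)
  from2to-unique = Unique.map⁺ (ℕₚ.+-cancelʳ-≡ 2 _ _) (Unique.upTo⁺ (n ∸ 1))
  sizes-differ : ∀ {m m'} → m ≢ m' → Disjoint (subsetsOfSize n m) (subsetsOfSize n m')
  sizes-differ m≢m' (p , q) =
    m≢m' (≡.trans (≡.sym (∈-subsetsOfSize⇒∣∣≡ p)) (∈-subsetsOfSize⇒∣∣≡ q))

subsetsBySize-unique : ∀ n → Unique (⊥ ∷ (singletons n ++ largeSubsets n))
subsetsBySize-unique n =
  All.tabulate ⊥∉ ∷ Unique.++⁺ (Unique.map⁺ ⁅⁆-injective (Unique.allFin⁺ n))
                                (largeSubsets-unique n)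
                                1≢large
  where
  1≢large : Disjoint (singletons n) (largeSubsets n)
  1≢large (p , q) with ∈-singletons⇒∣∣≡1 p | ∈-largeSubsets⇒2≤∣∣ q
  ... | ∣s∣≡1 | 2≤∣s∣ = ℕₚ.<⇒≢ 2≤∣s∣ (≡.sym ∣s∣≡1)
  ⊥∉ : ∀ {s} → s ∈ singletons n ++ largeSubsets n → ⊥ ≢ s
  ⊥∉ s∈ ≡.refl with ∈-++⁻ (singletons n) s∈
  ... | inj₁ p = ℕₚ.0≢1+n (≡.trans (≡.sym (∣⊥∣≡0 n)) (∈-singletons⇒∣∣≡1 p))
  ... | inj₂ q with ≡.subst (2 ≤_) (∣⊥∣≡0 n) (∈-largeSubsets⇒2≤∣∣ q)
  ... | ()

module SemiringSums {c ℓ : Level} (S : CommutativeSemiring c ℓ) where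
  open CommutativeSemiring S
  open import Algebra.Properties.Semiring.Sum semiring
  open import Algebra.Properties.CommutativeMonoid.Sum *-commutativeMonoid
    using () renaming (sum to ∏; sum-cong-≋ to ∏-cong)
  open import Relation.Binary.Reasoning.Setoid setoid
  open import Algebra.Solver.Ring.NaturalCoefficients.Default S
    using (solve; _:=_; _:+_; _:*_; con)

  sumₗ : List Carrier → Carrier
  sumₗ = foldr _+_ 0#

  sumₗ-applyUpTo : ∀ (F : ℕ → Carrier) f n →
    sumₗ (map F (applyUpTo f n)) ≡ ∑[ k < n ] F (f (toℕ k))
  sumₗ-applyUpTo F f zero = ≡.refl
  sumₗ-applyUpTo F f (suc n) = ≡.cong (F (f 0) +_) (sumₗ-applyUpTo F (f ∘ suc) n)

  sumₗ-map-cong : ∀ {a} {A : Set a} {f g : A → Carrier} → (∀ x → f x ≈ g x) →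
    ∀ xs → sumₗ (map f xs) ≈ sumₗ (map g xs)
  sumₗ-map-cong f≈g [] = refl
  sumₗ-map-cong f≈g (x ∷ xs) = +-cong (f≈g x) (sumₗ-map-cong f≈g xs)

  sumₗ-map-++ : ∀ {a} {A : Set a} (f : A → Carrier) xs ys →
    sumₗ (map f (xs ++ ys)) ≈ sumₗ (map f xs) + sumₗ (map f ys)
  sumₗ-map-++ f [] ys = sym (+-identityˡ _)
  sumₗ-map-++ f (x ∷ xs) ys = trans (+-congˡ (sumₗ-map-++ f xs ys)) (sym (+-assoc _ _ _))

  sumₗ-map-concatMap : ∀ {a b} {A : Set a} {B : Set b} (f : B → Carrier) (g : A → List B) xs →
    sumₗ (map f (concat (map g xs))) ≈ sumₗ (map (λ x → sumₗ (map f (g x))) xs)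
  sumₗ-map-concatMap f g [] = refl
  sumₗ-map-concatMap f g (x ∷ xs) =
    trans (sumₗ-map-++ f (g x) (concat (map g xs))) (+-congˡ (sumₗ-map-concatMap f g xs))

  sumₗ-map-∘ : ∀ {a b} {A : Set a} {B : Set b} (f : B → Carrier) (g : A → B) xs →
    sumₗ (map f (map g xs)) ≡ sumₗ (map (f ∘ g) xs)
  sumₗ-map-∘ f g xs = ≡.cong sumₗ (≡.sym (map-∘ xs))

  ∑-double : ∀ m (F : ℕ → Carrier) →
    ∑[ k < double m ] F (toℕ k) ≈ ∑[ k < m ] (F (double (toℕ k)) + F (suc (double (toℕ k))))
  ∑-double zero F = refl
  ∑-double (suc m) F = trans (sym (+-assoc _ _ _)) (+-congˡ (∑-double m (F ∘ suc ∘ suc)))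

  ∑-factorise : ∀ n (g : Fin n → ℕ → Carrier) →
    ∑[ k < 2 ^ n ] ∏ (λ i → g i (bit (toℕ k) i)) ≈ ∏ (λ i → g i 0 + g i 1)
  ∑-factorise zero g = +-identityʳ 1#
  ∑-factorise (suc n) g = begin
    ∑[ k < 2 ^ suc n ] P (toℕ k)
      ≡⟨ ≡.cong (λ N → ∑[ k < N ] P (toℕ k)) (2^-suc n) ⟩
    ∑[ k < double (2 ^ n) ] P (toℕ k)
      ≈⟨ ∑-double (2 ^ n) P ⟩
    ∑[ k < 2 ^ n ] (P (double (toℕ k)) + P (suc (double (toℕ k))))
      ≈⟨ sum-cong-≋ {2 ^ n} (λ k → pair (toℕ k)) ⟩
    ∑[ k < 2 ^ n ] ((g fzero 0 + g fzero 1) * Q (toℕ k))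
      ≈⟨ sym (*-distribˡ-sum {2 ^ n} _ (Q ∘ toℕ)) ⟩
    (g fzero 0 + g fzero 1) * ∑[ k < 2 ^ n ] Q (toℕ k)
      ≈⟨ *-congˡ (∑-factorise n (g ∘ fsuc)) ⟩
    ∏ (λ i → g i 0 + g i 1) ∎
    where
    P Q : ℕ → Carrier
    P m = ∏ (λ i → g i (bit m i))
    Q m = ∏ (λ i → g (fsuc i) (bit m i))
    digits : ∀ {m} b k → bit m ≗ b ◂ bit k → P m ≈ g fzero b * Q k
    digits b k eq = ∏-cong (λ i → reflexive (≡.cong (g i) (eq i)))
    pair : ∀ k → P (double k) + P (suc (double k)) ≈ (g fzero 0 + g fzero 1) * Q k
    pair k = trans (+-cong (digits 0 k (bit-double k)) (digits 1 k (bit-1+double k)))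
                   (sym (distribʳ _ _ _))

  ∑-*ˡ : ∀ {n} x (f : Vector Carrier n) → ∑[ j < n ] (x * f j) ≈ x * sum f
  ∑-*ˡ x f = sym (*-distribˡ-sum x f)

  ∑-zero : ∀ {n} {f : Vector Carrier n} → (∀ j → f j ≈ 0#) → sum f ≈ 0#
  ∑-zero {n} f≈0 = trans (sum-cong-≋ f≈0) (sum-replicate-zero n)

  module Parseval {k} {K : Set k} {N : ℕ} (φ : K → Vector Carrier N) (M : Carrier)
    (orthogonal : ∀ {x y} → x ≢ y → ∑[ j < N ] (φ x j * φ y j) ≈ 0#)
    (normalised : ∀ x → ∑[ j < N ] (φ x j * φ x j) ≈ M) where

    combination : List (K × Carrier) → Vector Carrier N
    combination L j = sumₗ (map (λ (x , w) → φ x j * w) L)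

    weightSquares : List (K × Carrier) → Carrier
    weightSquares L = sumₗ (map (λ (_ , w) → w * w) L)

    combination-orthogonal : ∀ x L → All (λ (y , _) → x ≢ y) L →
      ∑[ j < N ] (φ x j * combination L j) ≈ 0#
    combination-orthogonal x [] [] = ∑-zero {N} (λ j → zeroʳ (φ x j))
    combination-orthogonal x ((y , w) ∷ L) (x≢y ∷ x∉L) = begin
      ∑[ j < N ] (φ x j * (φ y j * w + C j))
        ≈⟨ sum-cong-≋ {N} (λ j → solve 4 (λ a b w c → a :* (b :* w :+ c) := w :* (a :* b) :+ a :* c)
                                         refl (φ x j) (φ y j) w (C j)) ⟩
      ∑[ j < N ] (w * (φ x j * φ y j) + φ x j * C j)
        ≈⟨ ∑-distrib-+ {N} _ _ ⟩
      ∑[ j < N ] (w * (φ x j * φ y j)) + ∑[ j < N ] (φ x j * C j)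
        ≈⟨ +-cong (trans (∑-*ˡ {N} w _) (*-congˡ (orthogonal x≢y)))
                  (combination-orthogonal x L x∉L) ⟩
      w * 0# + 0#
        ≈⟨ trans (+-identityʳ _) (zeroʳ w) ⟩
      0# ∎
      where
      C : Vector Carrier N
      C = combination L

    parseval : ∀ L → Unique (map proj₁ L) →
      ∑[ j < N ] (combination L j * combination L j) ≈ M * weightSquares L
    parseval [] [] = trans (∑-zero {N} (λ j → zeroˡ 0#)) (sym (zeroʳ M))
    parseval ((x , w) ∷ L) (x∉L ∷ L-unique) = begin
      ∑[ j < N ] ((φ x j * w + C j) * (φ x j * w + C j))
        ≈⟨ sum-cong-≋ {N} (λ j → solve 3 (λ a w c → (a :* w :+ c) :* (a :* w :+ c)
                                   := (w :* w) :* (a :* a) :+ ((w :+ w) :* (a :* c) :+ c :* c))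
                                         refl (φ x j) w (C j)) ⟩
      ∑[ j < N ] ((w * w) * (φ x j * φ x j) + ((w + w) * (φ x j * C j) + C j * C j))
        ≈⟨ trans (∑-distrib-+ {N} _ _) (+-congˡ (∑-distrib-+ {N} _ _)) ⟩
      ∑[ j < N ] ((w * w) * (φ x j * φ x j))
        + (∑[ j < N ] ((w + w) * (φ x j * C j)) + ∑[ j < N ] (C j * C j))
        ≈⟨ +-cong (trans (∑-*ˡ {N} _ _) (*-congˡ (normalised x)))
                  (+-cong (trans (∑-*ˡ {N} _ _) (*-congˡ (combination-orthogonal x L (All.map⁻ x∉L))))
                          (parseval L L-unique)) ⟩
      (w * w) * M + ((w + w) * 0# + M * q)
        ≈⟨ solve 3 (λ w M q → (w :* w) :* M :+ ((w :+ w) :* con 0 :+ M :* q) := M :* (w :* w :+ q))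
                   refl w M q ⟩
      M * (w * w + q) ∎
      where
      C : Vector Carrier N
      C = combination L
      q : Carrier
      q = weightSquares L

module Characters {c ℓ : Level} (R : CommutativeRing c ℓ) where
  open CommutativeRing R
  open RingDefs R
  open SemiringSums commutativeSemiring using (∑-factorise)
  open import Algebra.Properties.Ring ring using (-1*x≈-x; -‿involutive)
  open import Algebra.Properties.Semiring.Sum semiring using (sum-cong-≋; sum-syntax)
  open import Algebra.Properties.CommutativeMonoid.Sum *-commutativeMonoid
    using () renaming (sum to ∏; ∑-distrib-+ to ∏-distrib-*)
  open import Relation.Binary.Reasoning.Setoid setoid

  χ : ∀ {n} → Subset n → Vector Carrier (2 ^ n)
  χ s k = sgn (foldr ℕ._+_ 0 (map (bit (toℕ k)) (elems s)))

  sgn-+ : ∀ m n → sgn (m ℕ.+ n) ≈ sgn m * sgn n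
  sgn-+ zero n = sym (*-identityˡ _)
  sgn-+ (suc m) n = trans (*-congˡ (sgn-+ m n)) (sym (*-assoc _ _ _))

  sgn1*sgn1 : sgn 1 * sgn 1 ≈ 1#
  sgn1*sgn1 = begin
    (- 1# * 1#) * (- 1# * 1#) ≈⟨ *-cong (-1*x≈-x 1#) (-1*x≈-x 1#) ⟩
    - 1# * - 1#               ≈⟨ -1*x≈-x (- 1#) ⟩
    - (- 1#)                  ≈⟨ -‿involutive 1# ⟩
    1#                        ∎

  1+sgn1 : 1# + sgn 1 ≈ 0#
  1+sgn1 = trans (+-congˡ (-1*x≈-x 1#)) (-‿inverseʳ 1#)

  signAt : ∀ {n} → Subset n → Fin n → ℕ → Carrier
  signAt s i b = if does (i ∈? s) then sgn b else 1#

  sgn-sum-filter : ∀ {n} (s : Subset n) (g : Fin n → ℕ) xs →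
    sgn (foldr ℕ._+_ 0 (map g (filter (_∈? s) xs))) ≈ prodL (map (λ i → signAt s i (g i)) xs)
  sgn-sum-filter s g [] = refl
  sgn-sum-filter s g (i ∷ xs) with does (i ∈? s)
  ... | false = trans (sgn-sum-filter s g xs) (sym (*-identityˡ _))
  ... | true  = trans (sgn-+ (g i) _) (*-congˡ (sgn-sum-filter s g xs))

  prodL-allFin : ∀ {n} (f : Fin n → Carrier) → prodL (map f (allFin n)) ≡ ∏ f
  prodL-allFin {n} f = ≡.trans (≡.cong prodL (map-tabulate id f)) (prodL-tabulate f)
    where
    prodL-tabulate : ∀ {n} (f : Fin n → Carrier) → prodL (tabulate f) ≡ ∏ f
    prodL-tabulate {zero} f = ≡.refl
    prodL-tabulate {suc n} f = ≡.cong (f fzero *_) (prodL-tabulate (f ∘ fsuc))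

  χ≈∏signAt : ∀ {n} (s : Subset n) k → χ s k ≈ ∏ (λ i → signAt s i (bit (toℕ k) i))
  χ≈∏signAt {n} s k = trans (sgn-sum-filter s (bit (toℕ k)) (allFin n))
                             (reflexive (prodL-allFin {n} (λ i → signAt s i (bit (toℕ k) i))))

  signPairing : ∀ {n} → Subset n → Subset n → Fin n → Carrier
  signPairing s t i = signAt s i 0 * signAt t i 0 + signAt s i 1 * signAt t i 1

  ∑χ*χ≈∏signPairing : ∀ {n} (s t : Subset n) →
    ∑[ k < 2 ^ n ] (χ s k * χ t k) ≈ ∏ (signPairing s t)
  ∑χ*χ≈∏signPairing {n} s t = begin
    ∑[ k < 2 ^ n ] (χ s k * χ t k)
      ≈⟨ sum-cong-≋ {2 ^ n} (λ k → trans (*-cong (χ≈∏signAt s k) (χ≈∏signAt t k))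
                                         (sym (∏-distrib-* {n} _ _))) ⟩
    ∑[ k < 2 ^ n ] ∏ (λ i → signAt s i (bit (toℕ k) i) * signAt t i (bit (toℕ k) i))
      ≈⟨ ∑-factorise n (λ i b → signAt s i b * signAt t i b) ⟩
    ∏ (signPairing s t) ∎

  χ-normalised : ∀ {n} (s : Subset n) → ∑[ k < 2 ^ n ] (χ s k * χ s k) ≈ pow (1# + 1#) n
  χ-normalised s = trans (∑χ*χ≈∏signPairing s s) (∏-diagonal s)
    where
    ∏-diagonal : ∀ {n} (s : Subset n) → ∏ (signPairing s s) ≈ pow (1# + 1#) n
    ∏-diagonal []ᵥ = refl
    ∏-diagonal (inside ∷ᵥ s) = *-cong (+-cong (*-identityˡ 1#) sgn1*sgn1) (∏-diagonal s)
    ∏-diagonal (outside ∷ᵥ s) = *-cong (+-cong (*-identityˡ 1#) (*-identityˡ 1#)) (∏-diagonal s)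

  χ-orthogonal : ∀ {n} {s t : Subset n} → s ≢ t → ∑[ k < 2 ^ n ] (χ s k * χ t k) ≈ 0#
  χ-orthogonal {s = s} {t} s≢t = trans (∑χ*χ≈∏signPairing s t) (∏-offDiagonal s t s≢t)
    where
    ∏-offDiagonal : ∀ {n} (s t : Subset n) → s ≢ t → ∏ (signPairing s t) ≈ 0#
    ∏-offDiagonal []ᵥ []ᵥ s≢t = ⊥-elim (s≢t ≡.refl)
    ∏-offDiagonal (inside ∷ᵥ s) (inside ∷ᵥ t) s≢t =
      trans (*-congˡ (∏-offDiagonal s t (s≢t ∘ ≡.cong (inside ∷ᵥ_)))) (zeroʳ _)
    ∏-offDiagonal (outside ∷ᵥ s) (outside ∷ᵥ t) s≢t =
      trans (*-congˡ (∏-offDiagonal s t (s≢t ∘ ≡.cong (outside ∷ᵥ_)))) (zeroʳ _)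
    ∏-offDiagonal (inside ∷ᵥ s) (outside ∷ᵥ t) _ =
      trans (*-congʳ (trans (+-cong (*-identityʳ 1#) (*-identityʳ _)) 1+sgn1)) (zeroˡ _)
    ∏-offDiagonal (outside ∷ᵥ s) (inside ∷ᵥ t) _ =
      trans (*-congʳ (trans (+-cong (*-identityˡ 1#) (*-identityˡ _)) 1+sgn1)) (zeroˡ _)

  ∏-signAt-⊥ : ∀ {n} (g : Fin n → ℕ) → ∏ (λ i → signAt ⊥ i (g i)) ≈ 1#
  ∏-signAt-⊥ {zero} g = refl
  ∏-signAt-⊥ {suc n} g = trans (*-identityˡ _) (∏-signAt-⊥ (g ∘ fsuc))

  χ-⊥ : ∀ {n} k → χ (⊥ {n}) k ≈ 1#
  χ-⊥ {n} k = trans (χ≈∏signAt {n} ⊥ k) (∏-signAt-⊥ {n} (bit (toℕ k)))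

  χ-⁅⁆ : ∀ {n} (j : Fin n) k → χ ⁅ j ⁆ k ≈ sgn (bit (toℕ k) j)
  χ-⁅⁆ j k = trans (χ≈∏signAt ⁅ j ⁆ k) (∏-signAt-⁅⁆ j (bit (toℕ k)))
    where
    ∏-signAt-⁅⁆ : ∀ {n} (j : Fin n) (g : Fin n → ℕ) →
      ∏ (λ i → signAt ⁅ j ⁆ i (g i)) ≈ sgn (g j)
    ∏-signAt-⁅⁆ {suc n} fzero g = trans (*-congˡ (∏-signAt-⊥ (g ∘ fsuc))) (*-identityʳ _)
    ∏-signAt-⁅⁆ {suc n} (fsuc j) g = trans (*-identityˡ _) (∏-signAt-⁅⁆ j (g ∘ fsuc))

module Expansion {c ℓ : Level} (R : CommutativeRing c ℓ) {n : ℕ}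
  (a₀ : CommutativeRing.Carrier R) (a b : Fin n → CommutativeRing.Carrier R)
  (c' : Subset n → CommutativeRing.Carrier R) where
  open CommutativeRing R
  open RingDefs R
  open Characters R
  open SemiringSums commutativeSemiring
    using (sumₗ-map-cong; sumₗ-map-++; sumₗ-map-concatMap; sumₗ-map-∘; module Parseval)
  open Parseval (χ {n}) (pow (1# + 1#) n) χ-orthogonal χ-normalised public
  open import Algebra.Properties.CommutativeSemigroup *-commutativeSemigroup using (interchange)
  open import Relation.Binary.Reasoning.Setoid setoid

  -- Both inner n a₀ a b c' k and the bracket in RHS are gradedSum's, definitionally.
  gradedSum : Carrier → (Fin n → Carrier) → (Subset n → Carrier) → Carrier
  gradedSum x f g =
    x + sumL (map f (allFin n)) + sumL (map (λ m → sumL (map g (subsetsOfSize n m))) (from2to n))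

  gradedSum-cong : ∀ {x x' f f' g g'} → x ≈ x' → (∀ i → f i ≈ f' i) → (∀ s → g s ≈ g' s) →
    gradedSum x f g ≈ gradedSum x' f' g'
  gradedSum-cong x≈x' f≈f' g≈g' = +-cong (+-cong x≈x' (sumₗ-map-cong f≈f' (allFin n)))
    (sumₗ-map-cong (λ m → sumₗ-map-cong g≈g' (subsetsOfSize n m)) (from2to n))

  monomial : Subset n → Carrier
  monomial s = prodL (map a (elems s))

  singleTerm : Fin n → Subset n × Carrier
  singleTerm i = ⁅ i ⁆ , b i * a i

  largeTerm : Subset n → Subset n × Carrier
  largeTerm s = s , c' s * monomial s

  singleTerms largeTerms : List (Subset n × Carrier)
  singleTerms = map singleTerm (allFin n)
  largeTerms = concat (map (map largeTerm ∘ subsetsOfSize n) (from2to n))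

  terms : List (Subset n × Carrier)
  terms = (⊥ , a₀) ∷ (singleTerms ++ largeTerms)

  terms-unique : Unique (map proj₁ terms)
  terms-unique = ≡.subst Unique (≡.sym keys) (subsetsBySize-unique n)
    where
    largeKeys : map proj₁ largeTerms ≡ largeSubsets n
    largeKeys = ≡.trans (≡.sym (concat-map (map (map largeTerm ∘ subsetsOfSize n) (from2to n))))
      (≡.cong concat (≡.trans (≡.sym (map-∘ (from2to n)))
        (map-cong (λ m → ≡.trans (≡.sym (map-∘ (subsetsOfSize n m))) (map-id (subsetsOfSize n m)))
                  (from2to n))))
    keys : map proj₁ terms ≡ ⊥ ∷ (singletons n ++ largeSubsets n)
    keys = ≡.cong (⊥ ∷_) (≡.trans (map-++ proj₁ singleTerms largeTerms)
                                  (≡.cong₂ _++_ (≡.sym (map-∘ (allFin n))) largeKeys))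

  sumL-terms : (F : Subset n × Carrier → Carrier) →
    sumL (map F terms) ≈ gradedSum (F (⊥ , a₀)) (F ∘ singleTerm) (F ∘ largeTerm)
  sumL-terms F = begin
    F (⊥ , a₀) + sumL (map F (singleTerms ++ largeTerms))
      ≈⟨ +-congˡ (sumₗ-map-++ F singleTerms largeTerms) ⟩
    F (⊥ , a₀) + (sumL (map F singleTerms) + sumL (map F largeTerms))
      ≈⟨ sym (+-assoc _ _ _) ⟩
    F (⊥ , a₀) + sumL (map F singleTerms) + sumL (map F largeTerms)
      ≈⟨ +-cong (+-congˡ (reflexive (sumₗ-map-∘ F singleTerm (allFin n))))
                (trans (sumₗ-map-concatMap F (map largeTerm ∘ subsetsOfSize n) (from2to n))
                       (sumₗ-map-cong (λ m → reflexive (sumₗ-map-∘ F largeTerm (subsetsOfSize n m)))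
                                      (from2to n))) ⟩
    gradedSum (F (⊥ , a₀)) (F ∘ singleTerm) (F ∘ largeTerm) ∎

  inner≈combination : ∀ k → inner n a₀ a b c' (toℕ k) ≈ combination terms k
  inner≈combination k = sym (trans (sumL-terms (λ (s , w) → χ s k * w))
    (gradedSum-cong (trans (*-congʳ (χ-⊥ {n} k)) (*-identityˡ a₀))
                    (λ i → trans (*-congʳ (χ-⁅⁆ i k)) (sym (*-assoc _ _ _)))
                    (λ s → sym (*-assoc _ _ _))))

  pow-2 : ∀ x → pow x 2 ≈ x * x
  pow-2 x = *-congˡ (*-identityʳ x)

  prodL-squares : ∀ (f : Fin n → Carrier) xs →
    prodL (map (λ α → pow (f α) 2) xs) ≈ prodL (map f xs) * prodL (map f xs)
  prodL-squares f [] = sym (*-identityˡ 1#)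
  prodL-squares f (x ∷ xs) =
    trans (*-cong (pow-2 (f x)) (prodL-squares f xs)) (interchange _ _ _ _)

  squares≈weightSquares : gradedSum (pow a₀ 2) (λ i → pow (a i * b i) 2)
      (λ s → pow (c' s) 2 * prodL (map (λ α → pow (a α) 2) (elems s)))
    ≈ weightSquares terms
  squares≈weightSquares = sym (trans (sumL-terms (λ (_ , w) → w * w))
    (gradedSum-cong (sym (pow-2 a₀))
                    (λ i → sym (trans (pow-2 _) (*-cong (*-comm _ _) (*-comm _ _))))
                    (λ s → sym (trans (*-cong (pow-2 (c' s)) (prodL-squares a (elems s)))
                                      (interchange _ _ _ _)))))

theorem2p2 : {c ℓ : Level} (R : CommutativeRing c ℓ) (n : ℕ) → 1 ≤ n →
    (a₀ : CommutativeRing.Carrier R) →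
    (a b : Fin n → CommutativeRing.Carrier R) →
    (c' : Subset n → CommutativeRing.Carrier R) →
    CommutativeRing._≈_ R (RingDefs.S′ R n a₀ a b c') (RingDefs.RHS R n a₀ a b c')
theorem2p2 R n _ a₀ a b c' = begin
  S′ n a₀ a b c'
    ≡⟨ sumₗ-applyUpTo (λ k → pow (inner n a₀ a b c' k) 2) id (2 ^ n) ⟩
  ∑[ k < 2 ^ n ] pow (inner n a₀ a b c' (toℕ k)) 2
    ≈⟨ sum-cong-≋ {2 ^ n} (λ k → trans (pow-2 _)
                                       (*-cong (inner≈combination k) (inner≈combination k))) ⟩
  ∑[ k < 2 ^ n ] (combination terms k * combination terms k)
    ≈⟨ parseval terms terms-unique ⟩
  pow (1# + 1#) n * weightSquares terms
    ≈⟨ *-congˡ (sym squares≈weightSquares) ⟩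
  RHS n a₀ a b c' ∎
  where
  open CommutativeRing R
  open RingDefs R
  open SemiringSums commutativeSemiring using (sumₗ-applyUpTo)
  open Expansion R a₀ a b c'
  open import Algebra.Properties.Semiring.Sum semiring using (sum-cong-≋; sum-syntax)
  open import Relation.Binary.Reasoning.Setoid setoid
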